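{- Let $P$ be a fixed finite poset with $a(P)=m$. Then, as $n\to\infty$, \[\bigl|\mathrm{inj\text{ - }hom}_P(\mathcal{P}(n))\bigr| = m^n + O\bigl((m-1)^n\bigr).\]
   Context: $a(P)$ is the number of antichains of $P$, including the empty antichain. $\mathcal{P}(n)$ is the power set of $[n]$ ordered by inclusion. A poset homomorphism from $(P,\le_P)$ to $(Q,\le_Q)$ is a map $\phi:P\to Q$ with $x\le_P y\Rightarrow\phi(x)\le_Q\phi(y)$; $\mathrm{inj\text{ - }hom}_P(\mathcal{P}(n))$ is the set of injective poset homomorphisms from $P$ to $\mathcal{P}(n)$. -}

module Defs where

open import Level using (0ℓ)
open import Data.Nat.Base using (ℕ)
open import Data.Fin.Base using (Fin)
open import Data.Fin.Subset using (Subset; _∈_; _⊆_)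
open import Data.Vec.Base using (Vec; lookup)
open import Data.List.Base using (List; length)
open import Data.List.Relation.Unary.Unique.Propositional using (Unique)
import Data.List.Membership.Propositional as LM
open import Data.Product using (Σ; _×_)
open import Relation.Binary.PropositionalEquality using (_≡_)
open import Relation.Binary.Structures using (IsPartialOrder)

record FinPoset : Set₁ where
  field
    size : ℕ
    _≤_  : Fin size → Fin size → Set
    isPartialOrder : IsPartialOrder _≡_ _≤_

HasCount : {A : Set} → (A → Set) → ℕ → Set
HasCount {A} Q h =
  Σ (List A) λ xs → Unique xs × ((x : A) → (Q x → x LM.∈ xs) × (x LM.∈ xs → Q x)) × length xs ≡ h

module _ (P : FinPoset) where
  open FinPoset P

  -- Antichain of P (given as a subset of the carrier); the empty set is one.
  IsAntichain : Subset size → Set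
  IsAntichain A = (x y : Fin size) → x ∈ A → y ∈ A → x ≤ y → x ≡ y

  NumAntichains : ℕ → Set
  NumAntichains m = HasCount IsAntichain m

  IsInjHom : (n : ℕ) → Vec (Subset n) size → Set
  IsInjHom n φ =
    ((x y : Fin size) → x ≤ y → lookup φ x ⊆ lookup φ y) ×
    ((x y : Fin size) → lookup φ x ≡ lookup φ y → x ≡ y)

  NumInjHom : ℕ → ℕ → Set
  NumInjHom n h = HasCount (IsInjHom n) h

module Submission where

-- A homomorphism φ : P → 𝒫([n]) is a Boolean matrix with rows φ(x), x ∈ P,
-- whose columns {x | i ∈ φ(x)} are up-sets of P.  Up-sets correspond to
-- antichains (U ↦ minimals U, A ↦ ↑A), so homomorphisms correspond to
-- n-tuples of antichains: toTuple embeds the h injective homomorphisms into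
-- the m ^ n antichain tuples (upper bound).  Conversely toHom t is injective
-- unless two points x ≢ y are joined by every entry of t (each ↑tᵢ contains
-- both or neither).  A singleton antichain splits x and y, so at most m ∸ 1
-- antichains join them and at most (m ∸ 1) ^ n tuples do; summing over the
-- pairs gives m ^ n ≤ h + size² (m ∸ 1) ^ n (lower bound).
--
-- The order of P is not assumed decidable, but the
-- conclusion is a decidable inequality, so the finitely many order decisions
-- may be taken under ¬¬.

open import Defs
open import Data.Nat.Base using (ℕ; _≤_; _*_; _^_; _∸_; ∣_-_∣)
open import Data.Product using (Σ)

open import Level using (Level)
open import Function using (id; _∘_)
open import Data.Nat.Base using (zero; suc; z≤n; s≤s; _+_; pred)
open import Data.Nat.Properties
  using (module ≤-Reasoning; _≤?_; ≤-trans; ≤-reflexive; *-monoˡ-≤; +-mono-≤; *-assoc; ^-monoˡ-≤; <⇒≤pred;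
         m≤n⇒∣n-m∣≡n∸m; ∣-∣-comm; m≤n+o⇒m∸n≤o)
import Data.Bool.Properties as Bool
open import Data.Fin.Base using (Fin; zero; suc)
open import Data.Fin.Properties using (_≟_; any?; all?)
open import Data.Fin.Induction using (po-wellFounded)
open import Data.Fin.Subset using (Subset; _∈_; _⊆_; ⁅_⁆)
open import Data.Fin.Subset.Properties using (_∈?_; ⊆-antisym; x∈⁅x⁆; x∈⁅y⁆⇒x≡y)
open import Data.Vec.Base as Vec using (Vec; lookup; tabulate)
open import Data.Vec.Properties as Vecₚ
  using (lookup∘tabulate; tabulate∘lookup; tabulate-cong; lookup-map;
         []=⇒lookup; lookup⇒[]=; ∷-injective)
open import Data.List.Base as List
  using (List; []; _∷_; [_]; length; _++_; filter; concatMap; allFin; cartesianProductWith)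
open import Data.List.Properties
  using (length-++; length-map; length-filter; filter-notAll; length-removeAt′; length-tabulate)
open import Data.List.Relation.Unary.Any using (here; there; index)
open import Data.List.Relation.Unary.All as All using ()
open import Data.List.Relation.Unary.AllPairs using ([]; _∷_)
open import Data.List.Relation.Unary.Unique.Propositional using (Unique)
open import Data.List.Relation.Unary.Unique.Propositional.Properties
  using (cartesianProductWith⁺) renaming (filter⁺ to filter-unique)
import Data.List.Membership.Propositional as Mem
open import Data.List.Membership.Propositional using (_─_; lose)
open import Data.List.Membership.Propositional.Properties
  using (∈-cartesianProductWith⁺; ∈-cartesianProductWith⁻; ∈-filter⁺; ∈-filter⁻;
         ∈-concatMap⁺; ∈-allFin; ∈-++⁺ˡ; ∈-++⁺ʳ)
open import Data.Product using (_×_; _,_; proj₁; proj₂; ∃-syntax)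
open import Relation.Nullary using (Dec; yes; no; ¬_; ¬?; contradiction)
open import Relation.Nullary.Decidable
  using (does; _×-dec_; _→-dec_; decidable-stable; dec-true; ¬¬-excluded-middle)
open import Relation.Unary using (Pred; Decidable)
open import Relation.Binary.PropositionalEquality
  using (_≡_; _≢_; refl; sym; trans; cong; cong₂; subst; module ≡-Reasoning)
open import Relation.Binary.Structures using (IsPartialOrder)
open import Induction.WellFounded using (Acc; acc)
import Relation.Binary.Construct.NonStrictToStrict as NonStrictToStrict

private
  variable
    A B C : Set
    k n : ℕ

∈-─ : ∀ {x z : A} {ys} (x∈ys : x Mem.∈ ys) → z Mem.∈ ys → z ≢ x → z Mem.∈ ys ─ x∈ys
∈-─ (here refl) (here refl)  z≢x = contradiction refl z≢x
∈-─ (here refl) (there z∈ys) _   = z∈ys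
∈-─ (there _)   (here refl)  _   = here refl
∈-─ (there x∈ys) (there z∈ys) z≢x = there (∈-─ x∈ys z∈ys z≢x)

injection-length : (f : A → B) {xs : List A} {ys : List B} → Unique xs →
  (∀ {x} → x Mem.∈ xs → f x Mem.∈ ys) →
  (∀ {x y} → x Mem.∈ xs → y Mem.∈ xs → f x ≡ f y → x ≡ y) →
  length xs ≤ length ys
injection-length f {[]}     _             _    _   = z≤n
injection-length f {x ∷ xs} {ys} (x∉xs ∷ xs!) into inj = begin
  suc (length xs)            ≤⟨ s≤s (injection-length f xs! into′ inj′) ⟩
  suc (length (ys ─ fx∈ys))  ≡⟨ length-removeAt′ ys (index fx∈ys) ⟨
  length ys                  ∎
  where
    open ≤-Reasoning
    fx∈ys : f x Mem.∈ ys
    fx∈ys = into (here refl)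
    into′ : ∀ {z} → z Mem.∈ xs → f z Mem.∈ ys ─ fx∈ys
    into′ z∈xs = ∈-─ fx∈ys (into (there z∈xs))
      (λ fz≡fx → All.lookup x∉xs z∈xs (sym (inj (there z∈xs) (here refl) fz≡fx)))
    inj′ : ∀ {y z} → y Mem.∈ xs → z Mem.∈ xs → f y ≡ f z → y ≡ z
    inj′ y∈xs z∈xs = inj (there y∈xs) (there z∈xs)

length-concatMap-≤ : (f : A → List B) (xs : List A) {b : ℕ} →
  (∀ {x} → x Mem.∈ xs → length (f x) ≤ b) → length (concatMap f xs) ≤ length xs * b
length-concatMap-≤ f []       _     = z≤n
length-concatMap-≤ f (x ∷ xs) {b} bounded = begin
  length (f x ++ concatMap f xs)          ≡⟨ length-++ (f x) ⟩
  length (f x) + length (concatMap f xs)  ≤⟨ +-mono-≤ (bounded (here refl))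
                                               (length-concatMap-≤ f xs (bounded ∘ there)) ⟩
  b + length xs * b                       ∎
  where open ≤-Reasoning

length-allFin : ∀ k → length (allFin k) ≡ k
length-allFin k = length-tabulate id

tuples : (n : ℕ) → List A → List (Vec A n)
tuples zero    xs = [ Vec.[] ]
tuples (suc n) xs = cartesianProductWith Vec._∷_ xs (tuples n xs)

length-cartesianProductWith : (g : A → B → C) (xs : List A) (ys : List B) →
  length (cartesianProductWith g xs ys) ≡ length xs * length ys
length-cartesianProductWith g []       ys = refl
length-cartesianProductWith g (x ∷ xs) ys = begin
  length (List.map (g x) ys ++ cartesianProductWith g xs ys)          ≡⟨ length-++ (List.map (g x) ys) ⟩
  length (List.map (g x) ys) + length (cartesianProductWith g xs ys) ≡⟨ cong₂ _+_ (length-map (g x) ys)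
                                                                         (length-cartesianProductWith g xs ys) ⟩
  length ys + length xs * length ys                                   ∎
  where open ≡-Reasoning

length-tuples : (n : ℕ) (xs : List A) → length (tuples n xs) ≡ length xs ^ n
length-tuples zero    xs = refl
length-tuples (suc n) xs = trans (length-cartesianProductWith Vec._∷_ xs (tuples n xs))
                                 (cong (length xs *_) (length-tuples n xs))

∈-tuples⁺ : (xs : List A) {t : Vec A n} → (∀ i → lookup t i Mem.∈ xs) → t Mem.∈ tuples n xs
∈-tuples⁺ xs {Vec.[]}    _       = here refl
∈-tuples⁺ xs {a Vec.∷ t} entries =
  ∈-cartesianProductWith⁺ Vec._∷_ (entries zero) (∈-tuples⁺ xs (entries ∘ suc))

∈-tuples⁻ : (xs : List A) {t : Vec A n} → t Mem.∈ tuples n xs → ∀ i → lookup t i Mem.∈ xs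
∈-tuples⁻ {n = suc n} xs t∈ i with ∈-cartesianProductWith⁻ Vec._∷_ xs (tuples n xs) t∈
∈-tuples⁻ xs _ zero    | a , t , a∈xs , t∈ , refl = a∈xs
∈-tuples⁻ xs _ (suc i) | a , t , a∈xs , t∈ , refl = ∈-tuples⁻ xs t∈ i

tuples-unique : (n : ℕ) {xs : List A} → Unique xs → Unique (tuples n xs)
tuples-unique zero    _   = All.[] ∷ []
tuples-unique (suc n) xs! = cartesianProductWith⁺ Vec._∷_ ∷-injective xs! (tuples-unique n xs!)

module Enumeration {Q : A → Set} {h : ℕ} (count : HasCount Q h) where
  elems : List A
  elems = proj₁ count

  elems-unique : Unique elems
  elems-unique = proj₁ (proj₂ count)

  complete : ∀ {x} → Q x → x Mem.∈ elems
  complete {x} = proj₁ (proj₁ (proj₂ (proj₂ count)) x)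

  sound : ∀ {x} → x Mem.∈ elems → Q x
  sound {x} = proj₂ (proj₁ (proj₂ (proj₂ count)) x)

  length-elems : length elems ≡ h
  length-elems = proj₂ (proj₂ (proj₂ count))

¬¬-∀Fin : ∀ k {F : Fin k → Set} → (∀ i → ¬ ¬ F i) → ¬ ¬ (∀ i → F i)
¬¬-∀Fin zero    _    ¬all = ¬all (λ ())
¬¬-∀Fin (suc k) ¬¬F ¬all = ¬¬F zero λ F₀ → ¬¬-∀Fin k (¬¬F ∘ suc) λ Fₛ →
  ¬all λ { zero → F₀ ; (suc i) → Fₛ i }

lookup-ext : {u v : Vec A n} → (∀ i → lookup u i ≡ lookup v i) → u ≡ v
lookup-ext {u = u} {v} same = begin
  u                ≡⟨ tabulate∘lookup u ⟨
  tabulate (lookup u) ≡⟨ tabulate-cong same ⟩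
  tabulate (lookup v) ≡⟨ tabulate∘lookup v ⟩
  v                ∎
  where open ≡-Reasoning

select : {ℓ : Level} {Q : Pred (Fin k) ℓ} → Decidable Q → Subset k
select Q? = tabulate (λ x → does (Q? x))

module _ {ℓ : Level} {Q : Pred (Fin k) ℓ} (Q? : Decidable Q) where

  ∈-select⁺ : ∀ {x} → Q x → x ∈ select Q?
  ∈-select⁺ {x} q = lookup⇒[]= x _ (trans (lookup∘tabulate _ x) (dec-true (Q? x) q))

  ∈-select⁻ : ∀ {x} → x ∈ select Q? → Q x
  ∈-select⁻ {x} x∈ with Q? x | trans (sym (lookup∘tabulate _ x)) ([]=⇒lookup x∈)
  ... | yes q | _  = q
  ... | no _  | ()

_ᵀ : Vec (Subset k) n → Vec (Subset n) k
M ᵀ = tabulate λ x → tabulate λ i → lookup (lookup M i) x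

lookup-ᵀ : (M : Vec (Subset k) n) (x : Fin k) (i : Fin n) →
  lookup (lookup (M ᵀ) x) i ≡ lookup (lookup M i) x
lookup-ᵀ M x i = begin
  lookup (lookup (M ᵀ) x) i                               ≡⟨ cong (λ row → lookup row i) (lookup∘tabulate _ x) ⟩
  lookup (tabulate λ j → lookup (lookup M j) x) i         ≡⟨ lookup∘tabulate _ i ⟩
  lookup (lookup M i) x                                   ∎
  where open ≡-Reasoning

∈-ᵀ⁺ : (M : Vec (Subset k) n) {x : Fin k} {i : Fin n} → x ∈ lookup M i → i ∈ lookup (M ᵀ) x
∈-ᵀ⁺ M {x} {i} x∈ = lookup⇒[]= i _ (trans (lookup-ᵀ M x i) ([]=⇒lookup x∈))

∈-ᵀ⁻ : (M : Vec (Subset k) n) {x : Fin k} {i : Fin n} → i ∈ lookup (M ᵀ) x → x ∈ lookup M i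
∈-ᵀ⁻ M {x} {i} i∈ = lookup⇒[]= x _ (trans (sym (lookup-ᵀ M x i)) ([]=⇒lookup i∈))

ᵀ-involutive : (M : Vec (Subset k) n) → (M ᵀ) ᵀ ≡ M
ᵀ-involutive M = lookup-ext λ i → lookup-ext λ x →
  trans (lookup-ᵀ (M ᵀ) i x) (lookup-ᵀ M x i)

module DecidablePoset (P : FinPoset) (_⊑?_ : ∀ x y → Dec (FinPoset._≤_ P x y)) where
  open FinPoset P renaming (_≤_ to _⊑_)
  open IsPartialOrder isPartialOrder
    using () renaming (refl to ⊑-refl; trans to ⊑-trans; antisym to ⊑-antisym)
  open NonStrictToStrict _≡_ _⊑_ using (<-decidable) renaming (_<_ to _⊏_)

  above? : ∀ A x → Dec (∃[ a ] (a ∈ A × a ⊑ x))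
  above? A x = any? λ a → (a ∈? A) ×-dec (a ⊑? x)

  ↑_ : Subset size → Subset size
  ↑ A = select (above? A)

  ∈↑⁺ : ∀ {A a x} → a ∈ A → a ⊑ x → x ∈ ↑ A
  ∈↑⁺ {A} a∈A a⊑x = ∈-select⁺ (above? A) (_ , a∈A , a⊑x)

  ∈↑⁻ : ∀ {A x} → x ∈ ↑ A → ∃[ a ] (a ∈ A × a ⊑ x)
  ∈↑⁻ {A} = ∈-select⁻ (above? A)

  IsUpSet : Subset size → Set
  IsUpSet U = ∀ {x y} → x ⊑ y → x ∈ U → y ∈ U

  ↑-upSet : ∀ A → IsUpSet (↑ A)
  ↑-upSet A x⊑y x∈↑A with ∈↑⁻ x∈↑A
  ... | a , a∈A , a⊑x = ∈↑⁺ a∈A (⊑-trans a⊑x x⊑y)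

  Minimal : Subset size → Fin size → Set
  Minimal U x = x ∈ U × (∀ z → z ∈ U → z ⊑ x → z ≡ x)

  minimal? : ∀ U → Decidable (Minimal U)
  minimal? U x = (x ∈? U) ×-dec all? (λ z → (z ∈? U) →-dec ((z ⊑? x) →-dec (z ≟ x)))

  minimals : Subset size → Subset size
  minimals U = select (minimal? U)

  minimals-antichain : ∀ U → IsAntichain P (minimals U)
  minimals-antichain U x y x∈ y∈ x⊑y =
    proj₂ (∈-select⁻ (minimal? U) y∈) x (proj₁ (∈-select⁻ (minimal? U) x∈)) x⊑y

  -- Since P is finite its strict order is well founded, so descending
  -- inside U from any of its elements ends at a minimal element.
  minimal-below : ∀ U {x} → x ∈ U → ∃[ y ] (y ∈ minimals U × y ⊑ x)
  minimal-below U x∈U = descend (po-wellFounded isPartialOrder _) x∈U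
    where
      descend : ∀ {x} → Acc _⊏_ x → x ∈ U → ∃[ y ] (y ∈ minimals U × y ⊑ x)
      descend {x} (acc below) x∈U with any? (λ z → (z ∈? U) ×-dec <-decidable _≟_ _⊑?_ z x)
      ... | yes (z , z∈U , z⊏x) with descend (below z⊏x) z∈U
      ...   | y , y∈min , y⊑z = y , y∈min , ⊑-trans y⊑z (proj₁ z⊏x)
      descend {x} (acc below) x∈U | no ∄smaller = x , ∈-select⁺ (minimal? U) (x∈U , x-minimal) , ⊑-refl
        where
          x-minimal : ∀ z → z ∈ U → z ⊑ x → z ≡ x
          x-minimal z z∈U z⊑x = decidable-stable (z ≟ x) λ z≢x → ∄smaller (z , z∈U , z⊑x , z≢x)

  minimals-↑ : ∀ {A} → IsAntichain P A → minimals (↑ A) ≡ A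
  minimals-↑ {A} antichain = ⊆-antisym minimal⇒∈ ∈⇒minimal
    where
      minimal⇒∈ : minimals (↑ A) ⊆ A
      minimal⇒∈ {x} x∈ with ∈-select⁻ (minimal? (↑ A)) x∈
      ... | x∈↑A , x-minimal with ∈↑⁻ x∈↑A
      ...   | a , a∈A , a⊑x = subst (_∈ A) (x-minimal a (∈↑⁺ a∈A ⊑-refl) a⊑x) a∈A
      ∈⇒minimal : A ⊆ minimals (↑ A)
      ∈⇒minimal {x} x∈A = ∈-select⁺ (minimal? (↑ A)) (∈↑⁺ x∈A ⊑-refl , x-minimal)
        where
          x-minimal : ∀ z → z ∈ ↑ A → z ⊑ x → z ≡ x
          x-minimal z z∈↑A z⊑x with ∈↑⁻ z∈↑A
          ... | a , a∈A , a⊑z with antichain a x a∈A x∈A (⊑-trans a⊑z z⊑x)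
          ...   | refl = ⊑-antisym z⊑x a⊑z

  ↑-minimals : ∀ {U} → IsUpSet U → ↑ (minimals U) ≡ U
  ↑-minimals {U} upSet = ⊆-antisym above⇒∈ ∈⇒above
    where
      above⇒∈ : ↑ (minimals U) ⊆ U
      above⇒∈ x∈ with ∈↑⁻ x∈
      ... | a , a∈min , a⊑x = upSet a⊑x (proj₁ (∈-select⁻ (minimal? U) a∈min))
      ∈⇒above : U ⊆ ↑ (minimals U)
      ∈⇒above x∈U with minimal-below U x∈U
      ... | y , y∈min , y⊑x = ∈↑⁺ y∈min y⊑x

  -- A tuple (A₁,…,Aₙ) of subsets gives the map x ↦ {i | x ∈ ↑Aᵢ}; its
  -- columns are the up-sets ↑Aᵢ.
  toHom : Vec (Subset size) n → Vec (Subset n) size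
  toHom t = (Vec.map ↑_ t) ᵀ

  toTuple : Vec (Subset n) size → Vec (Subset size) n
  toTuple φ = Vec.map minimals (φ ᵀ)

  lookup-toHom : (t : Vec (Subset size) n) (x : Fin size) (i : Fin n) →
    lookup (lookup (toHom t) x) i ≡ lookup (↑ lookup t i) x
  lookup-toHom t x i = trans (lookup-ᵀ (Vec.map ↑_ t) x i)
                             (cong (λ U → lookup U x) (lookup-map i ↑_ t))

  ∈-toHom⁺ : (t : Vec (Subset size) n) {x : Fin size} {i : Fin n} →
    x ∈ ↑ lookup t i → i ∈ lookup (toHom t) x
  ∈-toHom⁺ t {x} {i} x∈ = lookup⇒[]= i _ (trans (lookup-toHom t x i) ([]=⇒lookup x∈))

  ∈-toHom⁻ : (t : Vec (Subset size) n) {x : Fin size} {i : Fin n} →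
    i ∈ lookup (toHom t) x → x ∈ ↑ lookup t i
  ∈-toHom⁻ t {x} {i} i∈ = lookup⇒[]= x _ (trans (sym (lookup-toHom t x i)) ([]=⇒lookup i∈))

  toHom-monotone : (t : Vec (Subset size) n) → ∀ x y → x ⊑ y → lookup (toHom t) x ⊆ lookup (toHom t) y
  toHom-monotone t x y x⊑y i∈ = ∈-toHom⁺ t (↑-upSet _ x⊑y (∈-toHom⁻ t i∈))

  toTuple-antichains : (φ : Vec (Subset n) size) → ∀ i → IsAntichain P (lookup (toTuple φ) i)
  toTuple-antichains φ i =
    subst (IsAntichain P) (sym (lookup-map i minimals (φ ᵀ))) (minimals-antichain (lookup (φ ᵀ) i))

  -- On homomorphisms toTuple is a left inverse of toHom, since columns are up-sets.
  toHom-toTuple : (φ : Vec (Subset n) size) →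
    (∀ x y → x ⊑ y → lookup φ x ⊆ lookup φ y) → toHom (toTuple φ) ≡ φ
  toHom-toTuple φ monotone = begin
    (Vec.map ↑_ (toTuple φ)) ᵀ  ≡⟨ cong _ᵀ columns-restored ⟩
    (φ ᵀ) ᵀ                     ≡⟨ ᵀ-involutive φ ⟩
    φ                           ∎
    where
      open ≡-Reasoning
      column-upSet : ∀ i → IsUpSet (lookup (φ ᵀ) i)
      column-upSet i {x} {y} x⊑y x∈ = ∈-ᵀ⁺ φ (monotone x y x⊑y (∈-ᵀ⁻ φ x∈))
      columns-restored : Vec.map ↑_ (toTuple φ) ≡ φ ᵀ
      columns-restored = lookup-ext λ i → begin
        lookup (Vec.map ↑_ (toTuple φ)) i  ≡⟨ lookup-map i ↑_ (toTuple φ) ⟩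
        ↑ lookup (toTuple φ) i             ≡⟨ cong ↑_ (lookup-map i minimals (φ ᵀ)) ⟩
        ↑ minimals (lookup (φ ᵀ) i)        ≡⟨ ↑-minimals (column-upSet i) ⟩
        lookup (φ ᵀ) i                     ∎

  -- On tuples of antichains toHom is injective, since ↑ is injective on antichains.
  toHom-injective : (t u : Vec (Subset size) n) →
    (∀ i → IsAntichain P (lookup t i)) → (∀ i → IsAntichain P (lookup u i)) →
    toHom t ≡ toHom u → t ≡ u
  toHom-injective t u t-antichains u-antichains same = lookup-ext λ i → begin
    lookup t i                         ≡⟨ minimals-↑ (t-antichains i) ⟨
    minimals (↑ lookup t i)            ≡⟨ cong minimals (up-sets-agree i) ⟩
    minimals (↑ lookup u i)            ≡⟨ minimals-↑ (u-antichains i) ⟩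
    lookup u i                         ∎
    where
      open ≡-Reasoning
      up-sets-agree : ∀ i → ↑ lookup t i ≡ ↑ lookup u i
      up-sets-agree i = begin
        ↑ lookup t i                 ≡⟨ lookup-map i ↑_ t ⟨
        lookup (Vec.map ↑_ t) i       ≡⟨ cong (λ M → lookup M i) (ᵀ-involutive (Vec.map ↑_ t)) ⟨
        lookup (toHom t ᵀ) i          ≡⟨ cong (λ φ → lookup (φ ᵀ) i) same ⟩
        lookup (toHom u ᵀ) i          ≡⟨ cong (λ M → lookup M i) (ᵀ-involutive (Vec.map ↑_ u)) ⟩
        lookup (Vec.map ↑_ u) i       ≡⟨ lookup-map i ↑_ u ⟩
        ↑ lookup u i                 ∎

  Joins : Fin size → Fin size → Subset size → Set
  Joins x y A = lookup (↑ A) x ≡ lookup (↑ A) y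

  joins? : ∀ x y → Decidable (Joins x y)
  joins? x y A = lookup (↑ A) x Bool.≟ lookup (↑ A) y

  singleton-antichain : ∀ a → IsAntichain P ⁅ a ⁆
  singleton-antichain a x y x∈ y∈ _ = trans (x∈⁅y⁆⇒x≡y a x∈) (sym (x∈⁅y⁆⇒x≡y a y∈))

  singleton-splits : ∀ {x y} → ¬ x ⊑ y → ¬ Joins x y ⁅ x ⁆
  singleton-splits {x} {y} x⋢y joined =
    let a , a∈⁅x⁆ , a⊑y = ∈↑⁻ y∈↑ in x⋢y (subst (_⊑ y) (x∈⁅y⁆⇒x≡y x a∈⁅x⁆) a⊑y)
    where
      y∈↑ : y ∈ ↑ ⁅ x ⁆
      y∈↑ = lookup⇒[]= y _ (trans (sym joined) ([]=⇒lookup (∈↑⁺ (x∈⁅x⁆ x) ⊑-refl)))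

  splitting-antichain : ∀ {x y} → x ≢ y → ∃[ A ] (IsAntichain P A × ¬ Joins x y A)
  splitting-antichain {x} {y} x≢y with x ⊑? y
  ... | no  x⋢y = ⁅ x ⁆ , singleton-antichain x , singleton-splits x⋢y
  ... | yes x⊑y = ⁅ y ⁆ , singleton-antichain y , singleton-splits y⋢x ∘ sym
    where y⋢x = λ y⊑x → x≢y (⊑-antisym x⊑y y⊑x)

  Collision : Vec (Subset size) n → Set
  Collision t = ∃[ x ] ∃[ y ] (x ≢ y × lookup (toHom t) x ≡ lookup (toHom t) y)

  collision? : Decidable (Collision {n})
  collision? t = any? λ x → any? λ y →
    ¬? (x ≟ y) ×-dec Vecₚ.≡-dec Bool._≟_ (lookup (toHom t) x) (lookup (toHom t) y)

  collision-free-injective : (t : Vec (Subset size) n) → ¬ Collision t →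
    ∀ x y → lookup (toHom t) x ≡ lookup (toHom t) y → x ≡ y
  collision-free-injective t no-collision x y same =
    decidable-stable (x ≟ y) λ x≢y → no-collision (x , y , x≢y , same)

  collision-joins : (t : Vec (Subset size) n) → ∀ {x y} →
    lookup (toHom t) x ≡ lookup (toHom t) y → ∀ i → Joins x y (lookup t i)
  collision-joins t {x} {y} same i = begin
    lookup (↑ lookup t i) x          ≡⟨ lookup-toHom t x i ⟨
    lookup (lookup (toHom t) x) i    ≡⟨ cong (λ row → lookup row i) same ⟩
    lookup (lookup (toHom t) y) i    ≡⟨ lookup-toHom t y i ⟩
    lookup (↑ lookup t i) y          ∎
    where open ≡-Reasoning

  module Bounds {m : ℕ} (antichainCount : NumAntichains P m)
                (n : ℕ) {h : ℕ} (injHomCount : NumInjHom P n h) where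
    module Antichains = Enumeration antichainCount
    module InjHoms    = Enumeration injHomCount

    antichainTuples : List (Vec (Subset size) n)
    antichainTuples = tuples n Antichains.elems

    length-antichainTuples : length antichainTuples ≡ m ^ n
    length-antichainTuples =
      trans (length-tuples n Antichains.elems) (cong (_^ n) Antichains.length-elems)

    antichainTuples-unique : Unique antichainTuples
    antichainTuples-unique = tuples-unique n Antichains.elems-unique

    entries-antichains : ∀ {t} → t Mem.∈ antichainTuples → ∀ i → IsAntichain P (lookup t i)
    entries-antichains t∈ i = Antichains.sound (∈-tuples⁻ Antichains.elems t∈ i)

    upper-bound : h ≤ m ^ n
    upper-bound = begin
      h                       ≡⟨ InjHoms.length-elems ⟨
      length InjHoms.elems    ≤⟨ injection-length toTuple InjHoms.elems-unique into injective ⟩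
      length antichainTuples  ≡⟨ length-antichainTuples ⟩
      m ^ n                   ∎
      where
        open ≤-Reasoning
        into : ∀ {φ} → φ Mem.∈ InjHoms.elems → toTuple φ Mem.∈ antichainTuples
        into {φ} _ = ∈-tuples⁺ Antichains.elems λ i → Antichains.complete (toTuple-antichains φ i)
        -- φ = toHom (toTuple φ) = toHom (toTuple ψ) = ψ.
        injective : ∀ {φ ψ} → φ Mem.∈ InjHoms.elems → ψ Mem.∈ InjHoms.elems →
          toTuple φ ≡ toTuple ψ → φ ≡ ψ
        injective {φ} {ψ} φ∈ ψ∈ same =
          trans (sym (toHom-toTuple φ (proj₁ (InjHoms.sound φ∈))))
                (trans (cong toHom same) (toHom-toTuple ψ (proj₁ (InjHoms.sound ψ∈))))

    collisionFree : List (Vec (Subset size) n)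
    collisionFree = filter (¬? ∘ collision?) antichainTuples

    ∈-collisionFree⁻ : ∀ {t} → t Mem.∈ collisionFree → t Mem.∈ antichainTuples × ¬ Collision t
    ∈-collisionFree⁻ = ∈-filter⁻ (¬? ∘ collision?) {xs = antichainTuples}

    -- Collision-free antichain tuples give distinct injective homomorphisms.
    length-collisionFree : length collisionFree ≤ h
    length-collisionFree = begin
      length collisionFree  ≤⟨ injection-length toHom (filter-unique (¬? ∘ collision?) antichainTuples-unique)
                                 into injective ⟩
      length InjHoms.elems  ≡⟨ InjHoms.length-elems ⟩
      h                     ∎
      where
        open ≤-Reasoning
        into : ∀ {t} → t Mem.∈ collisionFree → toHom t Mem.∈ InjHoms.elems
        into {t} t∈ = let _ , no-collision = ∈-collisionFree⁻ t∈ in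
          InjHoms.complete (toHom-monotone t , collision-free-injective t no-collision)
        injective : ∀ {t u} → t Mem.∈ collisionFree → u Mem.∈ collisionFree → toHom t ≡ toHom u → t ≡ u
        injective {t} {u} t∈ u∈ = toHom-injective t u
          (entries-antichains (proj₁ (∈-collisionFree⁻ t∈)))
          (entries-antichains (proj₁ (∈-collisionFree⁻ u∈)))

    -- Antichains joining x and y; for x ≢ y one antichain is missing.
    joining : Fin size → Fin size → List (Subset size)
    joining x y = filter (joins? x y) Antichains.elems

    length-joining : ∀ {x y} → x ≢ y → length (joining x y) ≤ m ∸ 1
    length-joining {x} {y} x≢y =
      let A , antichain , splits = splitting-antichain x≢y in
      subst (λ k → length (joining x y) ≤ pred k) Antichains.length-elems
        (<⇒≤pred (filter-notAll (joins? x y) Antichains.elems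
          (lose (Antichains.complete antichain) splits)))

    others : Fin size → List (Fin size)
    others x = filter (λ y → ¬? (x ≟ y)) (allFin size)

    ∈-others⁻ : ∀ {x y} → y Mem.∈ others x → x ≢ y
    ∈-others⁻ {x} y∈ = proj₂ (∈-filter⁻ (λ y → ¬? (x ≟ y)) {xs = allFin size} y∈)

    -- The antichain tuples with a collision lie in the union, over pairs
    -- x ≢ y, of the tuples of antichains joining x and y.
    joiningTuples : Fin size → Fin size → List (Vec (Subset size) n)
    joiningTuples x y = tuples n (joining x y)

    collisionsAt : Fin size → List (Vec (Subset size) n)
    collisionsAt x = concatMap (joiningTuples x) (others x)

    collisionCover : List (Vec (Subset size) n)
    collisionCover = concatMap collisionsAt (allFin size)

    collision-covered : ∀ {t} → t Mem.∈ antichainTuples → Collision t → t Mem.∈ collisionCover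
    collision-covered {t} t∈ (x , y , x≢y , same) =
      ∈-concatMap⁺ collisionsAt (lose (∈-allFin x) (∈-concatMap⁺ (joiningTuples x) (lose y∈others t∈joining)))
      where
        y∈others : y Mem.∈ others x
        y∈others = ∈-filter⁺ (λ y → ¬? (x ≟ y)) (∈-allFin y) x≢y
        t∈joining : t Mem.∈ joiningTuples x y
        t∈joining = ∈-tuples⁺ (joining x y) λ i →
          ∈-filter⁺ (joins? x y) (∈-tuples⁻ Antichains.elems t∈ i) (collision-joins t same i)

    length-collisionCover : length collisionCover ≤ size * (size * (m ∸ 1) ^ n)
    length-collisionCover = begin
      length collisionCover                         ≤⟨ length-concatMap-≤ collisionsAt (allFin size) row ⟩
      length (allFin size) * (size * (m ∸ 1) ^ n)   ≡⟨ cong (_* (size * (m ∸ 1) ^ n)) (length-allFin size) ⟩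
      size * (size * (m ∸ 1) ^ n)                   ∎
      where
        open ≤-Reasoning
        length-others : ∀ x → length (others x) ≤ size
        length-others x = ≤-trans (length-filter _ (allFin size)) (≤-reflexive (length-allFin size))
        block : ∀ {x y} → y Mem.∈ others x → length (joiningTuples x y) ≤ (m ∸ 1) ^ n
        block {x} {y} y∈ = ≤-trans (≤-reflexive (length-tuples n (joining x y)))
          (^-monoˡ-≤ n (length-joining (∈-others⁻ y∈)))
        row : ∀ {x} → x Mem.∈ allFin size → length (collisionsAt x) ≤ size * (m ∸ 1) ^ n
        row {x} _ = ≤-trans (length-concatMap-≤ (joiningTuples x) (others x) block) (*-monoˡ-≤ _ (length-others x))

    -- m ^ n ≤ h + size² (m ∸ 1) ^ n: every antichain tuple is collision-free or covered.
    lower-bound : m ^ n ≤ h + size * (size * (m ∸ 1) ^ n)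
    lower-bound = begin
      m ^ n                                               ≡⟨ length-antichainTuples ⟨
      length antichainTuples                              ≤⟨ injection-length id antichainTuples-unique
                                                              covered (λ _ _ → id) ⟩
      length (collisionFree ++ collisionCover)            ≡⟨ length-++ collisionFree ⟩
      length collisionFree + length collisionCover        ≤⟨ +-mono-≤ length-collisionFree length-collisionCover ⟩
      h + size * (size * (m ∸ 1) ^ n)                     ∎
      where
        open ≤-Reasoning
        covered : ∀ {t} → t Mem.∈ antichainTuples → t Mem.∈ collisionFree ++ collisionCover
        covered {t} t∈ with collision? t
        ... | yes collision    = ∈-++⁺ʳ collisionFree (collision-covered t∈ collision)
        ... | no  no-collision = ∈-++⁺ˡ (∈-filter⁺ (¬? ∘ collision?) t∈ no-collision)

    distance-bound : ∣ h - m ^ n ∣ ≤ size * size * (m ∸ 1) ^ n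
    distance-bound = begin
      ∣ h - m ^ n ∣                    ≡⟨ ∣-∣-comm h (m ^ n) ⟩
      ∣ m ^ n - h ∣                    ≡⟨ m≤n⇒∣n-m∣≡n∸m upper-bound ⟩
      m ^ n ∸ h                        ≤⟨ m≤n+o⇒m∸n≤o (m ^ n) h lower-bound ⟩
      size * (size * (m ∸ 1) ^ n)      ≡⟨ *-assoc size size _ ⟨
      size * size * (m ∸ 1) ^ n        ∎
      where open ≤-Reasoning

-- Constructively the order of P is decidable under ¬¬, as P is finite.
¬¬-decidable-order : (P : FinPoset) → ¬ ¬ (∀ x y → Dec (FinPoset._≤_ P x y))
¬¬-decidable-order P = ¬¬-∀Fin size λ x → ¬¬-∀Fin size λ y → ¬¬-excluded-middle
  where open FinPoset P using (size)

theorem3 : (P : FinPoset) (m : ℕ) → NumAntichains P m →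
    Σ ℕ λ C → Σ ℕ λ N → (n h : ℕ) → N ≤ n → NumInjHom P n h →
      ∣ h - m ^ n ∣ ≤ C * (m ∸ 1) ^ n
theorem3 P m antichainCount = size * size , 0 , λ n h _ injHomCount →
  -- The bound is a decidable statement, so it may be proved under ¬¬.
  decidable-stable (_ ≤? _) λ bound-fails →
    ¬¬-decidable-order P λ _⊑?_ →
      bound-fails (DecidablePoset.Bounds.distance-bound P _⊑?_ antichainCount n injHomCount)
  where open FinPoset P using (size)
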